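{- Let $G$ be a graph and $S\subseteq V(G)$. Then (i) $S$ is a $\{D\}$-forcing set of $G$ if and only if $S$ is a vertex cover of $G$; and (ii) $S$ is a $\{T\}$-forcing set of $G$ if and only if $S=V(G)$.
   Context: Vertices are colored blue or white. Color change rules: \emph{$Z$-rule}: if $v$ is blue and has exactly one white neighbor $w$, color $w$ blue. \emph{$T$-rule}: if $v$ is white and has exactly one white neighbor $w$, color $w$ blue. \emph{$D$-rule}: if $v$ is white and every neighbor of $v$ is blue, color $v$ blue. For a nonempty $\mathcal{R}\subseteq\{Z,T,D\}$, a set $S\subseteq V(G)$ is an \emph{$\mathcal{R}$-forcing set} if, starting with the vertices of $S$ blue and all others white, iteratively applying rules from $\mathcal{R}$ can color all vertices blue. A vertex cover is a set meeting every edge. -}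

module Defs where

open import Data.Nat using (ℕ)
open import Data.Fin using (Fin)
open import Data.Fin.Subset using (Subset; _∈_; _∉_; inside; ⊤)
open import Data.Vec using (_[_]≔_)
open import Data.Product using (Σ; _×_)
open import Data.Sum using (_⊎_)
open import Data.Empty using (⊥)
open import Relation.Binary.PropositionalEquality using (_≡_)
open import Relation.Binary.Construct.Closure.ReflexiveTransitive using (Star)
open import Level using (0ℓ; suc)

record Graph : Set₁ where
  field
    n     : ℕ
    Adj   : Fin n → Fin n → Set
    sym   : ∀ {u v} → Adj u v → Adj v u
    irrefl : ∀ {v} → Adj v v → ⊥

open Graph public

-- A coloring is a subset of the vertices: inside = blue, outside = white.
Coloring : Graph → Set
Coloring G = Subset (n G)

colorBlue : (G : Graph) → Coloring G → Fin (n G) → Coloring G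
colorBlue G B w = B [ w ]≔ inside

UniqueWhiteNbr : (G : Graph) → Coloring G → Fin (n G) → Fin (n G) → Set
UniqueWhiteNbr G B v w =
  Adj G v w × w ∉ B × (∀ u → Adj G v u → u ∉ B → u ≡ w)

data Rule : Set where
  Z T D : Rule

data Step (G : Graph) : Rule → Coloring G → Coloring G → Set where
  Z-rule : ∀ {B} v w → v ∈ B → UniqueWhiteNbr G B v w →
           Step G Z B (colorBlue G B w)
  T-rule : ∀ {B} v w → v ∉ B → UniqueWhiteNbr G B v w →
           Step G T B (colorBlue G B w)
  D-rule : ∀ {B} v → v ∉ B → (∀ u → Adj G v u → u ∈ B) →
           Step G D B (colorBlue G B v)

RuleStep : (G : Graph) → (Rule → Set) → Coloring G → Coloring G → Set
RuleStep G ℛ B B' = Σ Rule (λ r → ℛ r × Step G r B B')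

IsForcingSet : (G : Graph) → (Rule → Set) → Subset (n G) → Set
IsForcingSet G ℛ S = Star (RuleStep G ℛ) S ⊤

IsVertexCover : (G : Graph) → Subset (n G) → Set
IsVertexCover G S = ∀ u v → Adj G u v → u ∈ S ⊎ v ∈ S

-- Colour changes only ever add blue vertices.  Under the D-rule a vertex turns
-- blue only when all its neighbours already are, so an edge with both ends white
-- stays white forever; conversely, once S is a vertex cover every white vertex
-- has only blue neighbours and can be coloured directly.  The T-rule fires only
-- from a white vertex v at a neighbour w ≠ v, so v is still white afterwards:
-- a T-step never produces the all-blue colouring, hence (working back from the
-- end) a T-forcing sequence that reaches it has no steps at all.
module Submission where

open import Defs
open import Data.Empty using (⊥-elim)
open import Data.Fin using (Fin; _≟_)
open import Data.Fin.Subset using (Subset; ⊤; _∈_; _∉_; _⊆_; inside)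
open import Data.Fin.Subset.Properties using (∈⊤; ⊆⊤; ⊆-antisym; _∈?_)
open import Data.List using (List; []; _∷_; allFin)
open import Data.List.Membership.Propositional.Properties using (∈-allFin)
open import Data.List.Relation.Unary.All as All using (All; []; _∷_)
open import Data.Product using (Σ-syntax; _×_; _,_)
open import Data.Sum using (inj₁; inj₂)
open import Data.Vec using (_[_]≔_)
open import Data.Vec.Properties using ([]≔-updates; []≔-minimal; []=⇒lookup; lookup⇒[]=; lookup∘update′)
open import Function using (_∘_)
open import Function.Bundles using (_⇔_; mk⇔)
open import Relation.Binary.PropositionalEquality using (_≡_; _≢_; refl; trans; subst; ≢-sym)
  renaming (sym to ≡-sym)
open import Relation.Binary.Construct.Closure.ReflexiveTransitive using (Star; ε; _◅_)
open import Relation.Nullary using (yes; no)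

∈-[]≔⁻ : ∀ {m} {p : Subset m} {v w x} → v ≢ w → v ∈ p [ w ]≔ x → v ∈ p
∈-[]≔⁻ {p = p} {v} {w} {x} v≢w v∈p′ =
  lookup⇒[]= v p (trans (≡-sym (lookup∘update′ v≢w p x)) ([]=⇒lookup v∈p′))

p⊆p[w]≔inside : ∀ {m} (p : Subset m) (w : Fin m) → p ⊆ p [ w ]≔ inside
p⊆p[w]≔inside p w {v} v∈p with v ≟ w
... | yes refl = []≔-updates p v
... | no v≢w   = []≔-minimal p v w v≢w v∈p

module Forcing (G : Graph) where

  Vertex : Set
  Vertex = Fin (n G)

  Forces : (Rule → Set) → Coloring G → Coloring G → Set
  Forces ℛ = Star (RuleStep G ℛ)

  step-⊆ : ∀ {r B C} → Step G r B C → B ⊆ C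
  step-⊆ (Z-rule {B} _ w _ _) = p⊆p[w]≔inside B w
  step-⊆ (T-rule {B} _ w _ _) = p⊆p[w]≔inside B w
  step-⊆ (D-rule {B} v _ _)   = p⊆p[w]≔inside B v

  forces-⊆ : ∀ {ℛ B C} → Forces ℛ B C → B ⊆ C
  forces-⊆ ε                       = λ v∈B → v∈B
  forces-⊆ ((_ , _ , step) ◅ steps) = forces-⊆ steps ∘ step-⊆ step

  vertexCover-⊆ : ∀ {B C} → B ⊆ C → IsVertexCover G B → IsVertexCover G C
  vertexCover-⊆ B⊆C cover u v uv with cover u v uv
  ... | inj₁ u∈B = inj₁ (B⊆C u∈B)
  ... | inj₂ v∈B = inj₂ (B⊆C v∈B)

  vertexCover-white⇒neighbours-blue : ∀ {B v} → IsVertexCover G B → v ∉ B →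
                                       ∀ u → Adj G v u → u ∈ B
  vertexCover-white⇒neighbours-blue cover v∉B u vu with cover _ u vu
  ... | inj₁ v∈B = ⊥-elim (v∉B v∈B)
  ... | inj₂ u∈B = u∈B

  D-step-keeps-white-edge : ∀ {B C u v} → Step G D B C →
                            Adj G u v → u ∉ B → v ∉ B → u ∉ C
  D-step-keeps-white-edge {u = u} {v} (D-rule x _ neighbours-blue) uv u∉B v∉B u∈C
    with x ≟ u
  ... | yes refl = v∉B (neighbours-blue v uv)
  ... | no x≢u   = u∉B (∈-[]≔⁻ (≢-sym x≢u) u∈C)

  D-forces-keeps-white-edge : ∀ {B C u v} → Forces (_≡ D) B C →
                              Adj G u v → u ∉ B → v ∉ B → u ∉ C
  D-forces-keeps-white-edge ε _ u∉B _ = u∉B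
  D-forces-keeps-white-edge ((_ , refl , step) ◅ steps) uv u∉B v∉B =
    D-forces-keeps-white-edge steps uv
      (D-step-keeps-white-edge step uv u∉B v∉B)
      (D-step-keeps-white-edge step (sym G uv) v∉B u∉B)

  vertexCover-D-forces : ∀ {B} → IsVertexCover G B → (vs : List Vertex) →
                         Σ[ C ∈ Coloring G ] Forces (_≡ D) B C × All (_∈ C) vs
  vertexCover-D-forces {B} cover [] = B , ε , []
  vertexCover-D-forces {B} cover (x ∷ vs) with x ∈? B
  ... | yes x∈B =
    let C , steps , vs∈C = vertexCover-D-forces cover vs
    in C , steps , forces-⊆ steps x∈B ∷ vs∈C
  ... | no x∉B =
    let step = D-rule x x∉B (vertexCover-white⇒neighbours-blue cover x∉B)
        C , steps , vs∈C =
          vertexCover-D-forces (vertexCover-⊆ (step-⊆ step) cover) vs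
    in C , (D , refl , step) ◅ steps , forces-⊆ steps ([]≔-updates B x) ∷ vs∈C

  D-forcingSet⇒vertexCover : ∀ {S} → IsForcingSet G (_≡ D) S → IsVertexCover G S
  D-forcingSet⇒vertexCover {S} forcing u v uv with u ∈? S | v ∈? S
  ... | yes u∈S | _       = inj₁ u∈S
  ... | no _    | yes v∈S = inj₂ v∈S
  ... | no u∉S  | no v∉S  = ⊥-elim (D-forces-keeps-white-edge forcing uv u∉S v∉S ∈⊤)

  vertexCover⇒D-forcingSet : ∀ {S} → IsVertexCover G S → IsForcingSet G (_≡ D) S
  vertexCover⇒D-forcingSet {S} cover =
    let C , steps , all∈C = vertexCover-D-forces cover (allFin (n G))
    in subst (Forces (_≡ D) S) (⊆-antisym ⊆⊤ (λ {x} _ → All.lookup all∈C (∈-allFin x))) steps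

  T-step-leaves-white : ∀ {B C} → Step G T B C → Σ[ v ∈ Vertex ] v ∉ C
  T-step-leaves-white (T-rule v w v∉B (vw , _ , _)) =
    v , v∉B ∘ ∈-[]≔⁻ v≢w
    where
    v≢w : v ≢ w
    v≢w refl = irrefl G vw

  T-forces-⊤⇒⊤ : ∀ {B C} → Forces (_≡ T) B C → C ≡ ⊤ → B ≡ ⊤
  T-forces-⊤⇒⊤ ε C≡⊤ = C≡⊤
  T-forces-⊤⇒⊤ ((_ , refl , step) ◅ steps) C≡⊤ =
    let v , v∉B′ = T-step-leaves-white step
    in ⊥-elim (v∉B′ (subst (v ∈_) (≡-sym (T-forces-⊤⇒⊤ steps C≡⊤)) ∈⊤))

mainTheorem10 : (G : Graph) → (S : Subset (n G)) →
    (IsForcingSet G (_≡ D) S ⇔ IsVertexCover G S)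
    × (IsForcingSet G (_≡ T) S ⇔ S ≡ ⊤)
mainTheorem10 G S =
  mk⇔ D-forcingSet⇒vertexCover vertexCover⇒D-forcingSet ,
  mk⇔ (λ forcing → T-forces-⊤⇒⊤ forcing refl) (λ { refl → ε })
  where open Forcing G
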